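{- Let $\varepsilon$ be a formal variable with $\varepsilon^2=0$, and let $A_n=a_n+b_n\varepsilon\in\mathbb{Q}[\varepsilon]/(\varepsilon^2)$, $n\ge1$, be the sequence defined by $$A_{n+4}=\frac{A_{n+1}A_{n+3}+A_{n+2}^2(1+\varepsilon)}{A_n},\qquad A_1=A_2=A_3=A_4=1$$ (i.e. $a_1=\cdots=a_4=1$, $b_1=\cdots=b_4=0$). Then both sequences $(a_n)$ and $(b_n)$ consist of integers.
   Context: Division by $A_n$ is division in the ring of dual numbers $\mathbb{Q}[\varepsilon]/(\varepsilon^2)$, where $(a+b\varepsilon)^{ -1}=a^{ -1}-ba^{ -2}\varepsilon$ for $a\neq0$; the sequence $(a_n)$ is the Somos-$4$ sequence $a_{n+4}=(a_{n+1}a_{n+3}+a_{n+2}^2)/a_n$, whose terms are nonzero. -}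

module Defs where

open import Data.Nat using (ℕ; zero; suc)
open import Data.Integer using (ℤ)
open import Data.Rational using (ℚ; 0ℚ; 1ℚ; _+_; _*_; _-_; -_; 1/_; _/_; _≟_; ≢-nonZero)
open import Data.Product using (∃-syntax)
open import Relation.Nullary using (yes; no)
open import Relation.Binary.PropositionalEquality using (_≡_)

record Dual : Set where
  constructor _+_ε
  field
    re : ℚ
    du : ℚ
open Dual public

infixl 6 _⊕_
infixl 7 _⊗_

_⊕_ : Dual → Dual → Dual
(a + b ε) ⊕ (c + d ε) = (a + c) + (b + d) ε

_⊗_ : Dual → Dual → Dual
(a + b ε) ⊗ (c + d ε) = (a * c) + (a * d + b * c) ε

oneD : Dual
oneD = 1ℚ + 0ℚ ε

onePlusε : Dual
onePlusε = 1ℚ + 1ℚ ε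

-- Inverse of ℚ, totalised by 0⁻¹ := 0 (never used on the actual sequence,
-- whose real parts are the nonzero Somos-4 terms).
invℚ : ℚ → ℚ
invℚ a with a ≟ 0ℚ
... | yes _ = 0ℚ
... | no a≢0 = 1/_ a {{≢-nonZero a≢0}}

invD : Dual → Dual
invD (a + b ε) = invℚ a + (- (b * (invℚ a * invℚ a))) ε

_⊘_ : Dual → Dual → Dual
x ⊘ y = x ⊗ invD y

-- A n for n ≥ 1; A 0 is an unused junk value.
A : ℕ → Dual
A zero = oneD
A (suc zero) = oneD
A (suc (suc zero)) = oneD
A (suc (suc (suc zero))) = oneD
A (suc (suc (suc (suc zero)))) = oneD
-- A_{m+4} with m = n+1 ≥ 1:
-- A_{m+4} = (A_{m+1} A_{m+3} + A_{m+2}² (1+ε)) / A_m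
A (suc (suc (suc (suc (suc n))))) =
  (A (suc (suc n)) ⊗ A (suc (suc (suc (suc n))))
    ⊕ (A (suc (suc (suc n))) ⊗ A (suc (suc (suc n)))) ⊗ onePlusε)
  ⊘ A (suc n)

a b : ℕ → ℚ
a n = re (A n)
b n = du (A n)

IsInteger : ℚ → Set
IsInteger q = ∃[ z ] q ≡ z / 1

module Submission where

-- We work in the ring ℤ[ε] ⊆ ℚ[ε] of dual numbers with integer coordinates, where
-- 1+ε is a unit.  The argument is the classical coprimality proof of the Laurent
-- phenomenon for Somos-4:
--   * (Gauss)  if z is Bézout-coprime to g and z ∣ g t, then z ∣ t;
--   * (key congruence)  for seven consecutive integral terms W X Y Z P Q R, in which
--     Z divides W Y + X² (1+ε), the numerator T = P R + Q² (1+ε) of the next term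
--     satisfies  W Y X² T ≡ 0 (mod Z);
--   * (coprimality propagates)  if s z = t x + c with x coprime to c, then s is
--     coprime to x; this shows that every new term is coprime to its three predecessors.
-- Since Z is coprime to W, X, Y, Gauss gives Z ∣ T, so the next term T / Z is integral.
--
-- For the actual sequence, the real parts (the Somos-4 numbers) are
-- positive, so every division is exact and the recurrence holds with the division
-- cleared; an invariant on a sliding window of seven terms then gives the theorem.

open import Defs
open import Data.Nat using (ℕ; zero; suc; _≥_) renaming (_+_ to _+ₙ_)
open import Data.Integer as ℤ using (ℤ; +_; -[1+_])
import Data.Integer.Properties as ℤ
open import Data.Rational using (ℚ; 0ℚ; 1ℚ; _+_; _*_; -_; _/_; _≟_; Positive; ≢-nonZero; toℚᵘ)
import Data.Rational.Properties as ℚ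
open import Data.Rational.Solver using (module +-*-Solver)
import Data.Rational.Unnormalised as ℚᵘ
import Data.Rational.Unnormalised.Properties as ℚᵘₚ
open import Data.Product using (_×_; _,_; proj₁; proj₂)
open import Data.Maybe using (Maybe; just; nothing)
open import Data.Empty using (⊥-elim)
open import Function using (_$_)
open import Relation.Nullary using (yes; no)
open import Relation.Binary.PropositionalEquality
open import Algebra.Bundles using (CommutativeRing)
open import Algebra.Structures {A = Dual} _≡_ using (IsCommutativeRing)
import Tactic.RingSolver.Core.AlmostCommutativeRing as ACR
open import Tactic.RingSolver using (solve-∀)
import Relation.Binary.Reasoning.Base.Single as SingleReasoning

zeroD : Dual
zeroD = 0ℚ + 0ℚ ε

negD : Dual → Dual
negD (x + y ε) = (- x) + (- y) ε

dual-≡ : ∀ {x y x′ y′} → x ≡ x′ → y ≡ y′ → (x + y ε) ≡ (x′ + y′ ε)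
dual-≡ = cong₂ _+_ε

module DualLaws where
  open +-*-Solver

  ⊕-assoc : ∀ x y z → (x ⊕ y) ⊕ z ≡ x ⊕ (y ⊕ z)
  ⊕-assoc (a + b ε) (c + d ε) (e + f ε) = dual-≡ (ℚ.+-assoc a c e) (ℚ.+-assoc b d f)

  ⊕-comm : ∀ x y → x ⊕ y ≡ y ⊕ x
  ⊕-comm (a + b ε) (c + d ε) = dual-≡ (ℚ.+-comm a c) (ℚ.+-comm b d)

  ⊕-identityˡ : ∀ x → zeroD ⊕ x ≡ x
  ⊕-identityˡ (a + b ε) = dual-≡ (ℚ.+-identityˡ a) (ℚ.+-identityˡ b)

  ⊕-identityʳ : ∀ x → x ⊕ zeroD ≡ x
  ⊕-identityʳ (a + b ε) = dual-≡ (ℚ.+-identityʳ a) (ℚ.+-identityʳ b)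

  ⊕-inverseˡ : ∀ x → negD x ⊕ x ≡ zeroD
  ⊕-inverseˡ (a + b ε) = dual-≡ (ℚ.+-inverseˡ a) (ℚ.+-inverseˡ b)

  ⊕-inverseʳ : ∀ x → x ⊕ negD x ≡ zeroD
  ⊕-inverseʳ (a + b ε) = dual-≡ (ℚ.+-inverseʳ a) (ℚ.+-inverseʳ b)

  ⊗-assoc : ∀ x y z → (x ⊗ y) ⊗ z ≡ x ⊗ (y ⊗ z)
  ⊗-assoc (a + b ε) (c + d ε) (e + f ε) = dual-≡ (ℚ.*-assoc a c e)
    (solve 6 (λ a b c d e f → (a :* c) :* f :+ (a :* d :+ b :* c) :* e
                              := a :* (c :* f :+ d :* e) :+ b :* (c :* e)) refl a b c d e f)

  ⊗-comm : ∀ x y → x ⊗ y ≡ y ⊗ x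
  ⊗-comm (a + b ε) (c + d ε) = dual-≡ (ℚ.*-comm a c)
    (solve 4 (λ a b c d → a :* d :+ b :* c := c :* b :+ d :* a) refl a b c d)

  ⊗-identityˡ : ∀ x → oneD ⊗ x ≡ x
  ⊗-identityˡ (a + b ε) = dual-≡ (ℚ.*-identityˡ a)
    (solve 2 (λ a b → con 1ℚ :* b :+ con 0ℚ :* a := b) refl a b)

  ⊗-identityʳ : ∀ x → x ⊗ oneD ≡ x
  ⊗-identityʳ x = trans (⊗-comm x oneD) (⊗-identityˡ x)

  ⊗-distribˡ-⊕ : ∀ x y z → x ⊗ (y ⊕ z) ≡ (x ⊗ y) ⊕ (x ⊗ z)
  ⊗-distribˡ-⊕ (a + b ε) (c + d ε) (e + f ε) =
    dual-≡ (ℚ.*-distribˡ-+ a c e)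
      (solve 6 (λ a b c d e f → a :* (d :+ f) :+ b :* (c :+ e)
                                := (a :* d :+ b :* c) :+ (a :* f :+ b :* e)) refl a b c d e f)

  ⊗-distribʳ-⊕ : ∀ x y z → (y ⊕ z) ⊗ x ≡ (y ⊗ x) ⊕ (z ⊗ x)
  ⊗-distribʳ-⊕ x y z = trans (⊗-comm (y ⊕ z) x)
    (trans (⊗-distribˡ-⊕ x y z) (cong₂ _⊕_ (⊗-comm x y) (⊗-comm x z)))

  isCommutativeRing : IsCommutativeRing _⊕_ _⊗_ negD zeroD oneD
  isCommutativeRing = record
    { isRing = record
      { +-isAbelianGroup = record
        { isGroup = record
          { isMonoid = record
            { isSemigroup = record
              { isMagma = record { isEquivalence = isEquivalence ; ∙-cong = cong₂ _⊕_ }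
              ; assoc = ⊕-assoc }
            ; identity = ⊕-identityˡ , ⊕-identityʳ }
          ; inverse = ⊕-inverseˡ , ⊕-inverseʳ
          ; ⁻¹-cong = cong negD }
        ; comm = ⊕-comm }
      ; *-cong = cong₂ _⊗_
      ; *-assoc = ⊗-assoc
      ; *-identity = ⊗-identityˡ , ⊗-identityʳ
      ; distrib = ⊗-distribˡ-⊕ , ⊗-distribʳ-⊕ }
    ; *-comm = ⊗-comm }

open DualLaws using (⊗-comm; ⊗-assoc; ⊗-identityˡ; ⊗-identityʳ; isCommutativeRing)

dualRing : CommutativeRing _ _
dualRing = record { isCommutativeRing = isCommutativeRing }

zero≟ : ∀ x → Maybe (zeroD ≡ x)
zero≟ (a + b ε) with 0ℚ ≟ a | 0ℚ ≟ b
... | yes p | yes q = just (dual-≡ p q)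
... | _     | _     = nothing

Dual-ring : ACR.AlmostCommutativeRing _ _
Dual-ring = ACR.fromCommutativeRing dualRing zero≟

-- The integers form a subring of ℚ (an integer being a rational of the form i / 1).
-- We compute in unnormalised rationals, where i / 1 is literally the fraction i/1.

module IntegerSubring where
  open ℚᵘ using (_≃_; *≡*)
  open ℚᵘₚ using (≃-trans)

  fraction : ℤ → ℚᵘ.ℚᵘ
  fraction i = ℚᵘ.mkℚᵘ i 0

  integer-of-≃ : ∀ {p} i → toℚᵘ p ≃ fraction i → IsInteger p
  integer-of-≃ {p} i eq = i , trans (sym (ℚ.fromℚᵘ-toℚᵘ p)) (ℚ.fromℚᵘ-cong eq)

  toℚᵘ-integer : ∀ i → toℚᵘ (i / 1) ≃ fraction i
  toℚᵘ-integer i = ℚ.toℚᵘ-fromℚᵘ (fraction i)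

  integer-+ : ∀ {p q} → IsInteger p → IsInteger q → IsInteger (p + q)
  integer-+ (i , refl) (j , refl) = integer-of-≃ (i ℤ.+ j)
    (≃-trans (ℚ.toℚᵘ-homo-+ (i / 1) (j / 1))
    (≃-trans (ℚᵘₚ.+-cong (toℚᵘ-integer i) (toℚᵘ-integer j))
             (*≡* (cong (ℤ._* + 1) (cong₂ ℤ._+_ (ℤ.*-identityʳ i) (ℤ.*-identityʳ j))))))

  integer-* : ∀ {p q} → IsInteger p → IsInteger q → IsInteger (p * q)
  integer-* (i , refl) (j , refl) = integer-of-≃ (i ℤ.* j)
    (≃-trans (ℚ.toℚᵘ-homo-* (i / 1) (j / 1))
    (≃-trans (ℚᵘₚ.*-cong (toℚᵘ-integer i) (toℚᵘ-integer j)) (*≡* refl)))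

  integer-neg : ∀ {p} → IsInteger p → IsInteger (- p)
  integer-neg (i , refl) = integer-of-≃ (ℤ.- i)
    (≃-trans (ℚ.toℚᵘ-homo‿- (i / 1)) (ℚᵘₚ.-‿cong (toℚᵘ-integer i)))

open IntegerSubring using (integer-+; integer-*; integer-neg)

Integral : Dual → Set
Integral x = IsInteger (re x) × IsInteger (du x)

integral-⊕ : ∀ {x y} → Integral x → Integral y → Integral (x ⊕ y)
integral-⊕ {_ + _ ε} {_ + _ ε} (ia , ib) (ic , id) = integer-+ ia ic , integer-+ ib id

integral-⊗ : ∀ {x y} → Integral x → Integral y → Integral (x ⊗ y)
integral-⊗ {_ + _ ε} {_ + _ ε} (ia , ib) (ic , id) =
  integer-* ia ic , integer-+ (integer-* ia id) (integer-* ib ic)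

integral-neg : ∀ {x} → Integral x → Integral (negD x)
integral-neg {_ + _ ε} (ia , ib) = integer-neg ia , integer-neg ib

ℤ-dual : ℤ → ℤ → Dual
ℤ-dual i j = (i / 1) + (j / 1) ε

ℤ-dual-integral : ∀ i j → Integral (ℤ-dual i j)
ℤ-dual-integral i j = (i , refl) , (j , refl)

integral-0 : Integral zeroD
integral-0 = ℤ-dual-integral (+ 0) (+ 0)

integral-1 : Integral oneD
integral-1 = ℤ-dual-integral (+ 1) (+ 0)

β : Dual
β = onePlusε

integral-β : Integral β
integral-β = ℤ-dual-integral (+ 1) (+ 1)

β⁻¹ : Dual
β⁻¹ = ℤ-dual (+ 1) -[1+ 0 ]

integral-β⁻¹ : Integral β⁻¹
integral-β⁻¹ = ℤ-dual-integral (+ 1) -[1+ 0 ]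

β⁻¹-inverse : β⁻¹ ⊗ β ≡ oneD
β⁻¹-inverse = refl

infix 4 _≈_[mod_]

record _≈_[mod_] (x y z : Dual) : Set where
  constructor multiple
  field
    factor          : Dual
    factor-integral : Integral factor
    difference      : x ≡ y ⊕ z ⊗ factor

≈-refl : ∀ {z x} → x ≈ x [mod z ]
≈-refl {z} {x} = multiple zeroD integral-0 (add-zero x z)
  where
  add-zero : ∀ x z → x ≡ x ⊕ z ⊗ zeroD
  add-zero = solve-∀ Dual-ring

≈-trans : ∀ {z x y w} → x ≈ y [mod z ] → y ≈ w [mod z ] → x ≈ w [mod z ]
≈-trans {z} {x} {y} {w} (multiple k ik x≡) (multiple k′ ik′ y≡) =
  multiple (k′ ⊕ k) (integral-⊕ ik′ ik) $ trans x≡ (trans (cong (_⊕ z ⊗ k) y≡) (collect w z k′ k))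
  where
  collect : ∀ w z k′ k → (w ⊕ z ⊗ k′) ⊕ z ⊗ k ≡ w ⊕ z ⊗ (k′ ⊕ k)
  collect = solve-∀ Dual-ring

≈-+ : ∀ {z x y x′ y′} → x ≈ y [mod z ] → x′ ≈ y′ [mod z ] → x ⊕ x′ ≈ y ⊕ y′ [mod z ]
≈-+ {z} {x} {y} {x′} {y′} (multiple k ik x≡) (multiple k′ ik′ x′≡) =
  multiple (k ⊕ k′) (integral-⊕ ik ik′) $ trans (cong₂ _⊕_ x≡ x′≡) (collect y y′ z k k′)
  where
  collect : ∀ y y′ z k k′ → (y ⊕ z ⊗ k) ⊕ (y′ ⊕ z ⊗ k′) ≡ (y ⊕ y′) ⊕ z ⊗ (k ⊕ k′)
  collect = solve-∀ Dual-ring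

≈-scale : ∀ {z x y c} → Integral c → x ≈ y [mod z ] → c ⊗ x ≈ c ⊗ y [mod z ]
≈-scale {z} {x} {y} {c} ic (multiple k ik x≡) =
  multiple (c ⊗ k) (integral-⊗ ic ik) $ trans (cong (c ⊗_) x≡) (collect c y z k)
  where
  collect : ∀ c y z k → c ⊗ (y ⊕ z ⊗ k) ≡ c ⊗ y ⊕ z ⊗ (c ⊗ k)
  collect = solve-∀ Dual-ring

≈-* : ∀ {z x y x′ y′} → Integral x → Integral y′ →
      x ≈ y [mod z ] → x′ ≈ y′ [mod z ] → x ⊗ x′ ≈ y ⊗ y′ [mod z ]
≈-* {z} {x} {y} {x′} {y′} ix iy′ x≈y x′≈y′ =
  ≈-trans (≈-scale ix x′≈y′)
    (subst₂ (λ a b → a ≈ b [mod z ]) (⊗-comm y′ x) (⊗-comm y′ y) (≈-scale iy′ x≈y))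

module ≈-Reasoning (z : Dual) =
  SingleReasoning (λ x y → x ≈ y [mod z ]) ≈-refl ≈-trans

record Coprime (x y : Dual) : Set where
  constructor bezout
  field
    u v        : Dual
    u-integral : Integral u
    v-integral : Integral v
    identity   : u ⊗ x ⊕ v ⊗ y ≡ oneD

coprime-sym : ∀ {x y} → Coprime x y → Coprime y x
coprime-sym {x} {y} (bezout u v iu iv e) = bezout v u iv iu (trans (DualLaws.⊕-comm (v ⊗ y) (u ⊗ x)) e)

-- If z is coprime to a and to b, it is coprime to a b: multiply the two identities.
coprime-* : ∀ {z a b} → Integral z → Integral a → Integral b →
            Coprime z a → Coprime z b → Coprime z (a ⊗ b)
coprime-* {z} {a} {b} iz ia ib (bezout u v iu iv e) (bezout u′ v′ iu′ iv′ e′) =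
  bezout (u ⊗ u′ ⊗ z ⊕ u ⊗ v′ ⊗ b ⊕ v ⊗ a ⊗ u′) (v ⊗ v′)
    (integral-⊕ (integral-⊕ (integral-⊗ (integral-⊗ iu iu′) iz) (integral-⊗ (integral-⊗ iu iv′) ib))
                (integral-⊗ (integral-⊗ iv ia) iu′))
    (integral-⊗ iv iv′)
    (trans (expand u z v a u′ v′ b) (cong₂ _⊗_ e e′))
  where
  expand : ∀ u z v a u′ v′ b →
    (u ⊗ u′ ⊗ z ⊕ u ⊗ v′ ⊗ b ⊕ v ⊗ a ⊗ u′) ⊗ z ⊕ (v ⊗ v′) ⊗ (a ⊗ b)
      ≡ (u ⊗ z ⊕ v ⊗ a) ⊗ (u′ ⊗ z ⊕ v′ ⊗ b)
  expand = solve-∀ Dual-ring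

coprime-*β : ∀ {x y} → Coprime x y → Coprime x (y ⊗ β)
coprime-*β {x} {y} (bezout u v iu iv e) =
  bezout u (v ⊗ β⁻¹) iu (integral-⊗ iv integral-β⁻¹) $ begin
    u ⊗ x ⊕ (v ⊗ β⁻¹) ⊗ (y ⊗ β)   ≡⟨ regroup u x v β⁻¹ y β ⟩
    u ⊗ x ⊕ v ⊗ ((β⁻¹ ⊗ β) ⊗ y)   ≡⟨ cong (λ w → u ⊗ x ⊕ v ⊗ (w ⊗ y)) β⁻¹-inverse ⟩
    u ⊗ x ⊕ v ⊗ (oneD ⊗ y)        ≡⟨ cong (λ w → u ⊗ x ⊕ v ⊗ w) (⊗-identityˡ y) ⟩
    u ⊗ x ⊕ v ⊗ y                 ≡⟨ e ⟩
    oneD                          ∎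
  where
  open ≡-Reasoning
  regroup : ∀ u x v b′ y b → u ⊗ x ⊕ (v ⊗ b′) ⊗ (y ⊗ b) ≡ u ⊗ x ⊕ v ⊗ ((b′ ⊗ b) ⊗ y)
  regroup = solve-∀ Dual-ring

coprime-1 : ∀ x → Coprime x oneD
coprime-1 x = bezout zeroD oneD integral-0 integral-1 (only-one x)
  where
  only-one : ∀ x → zeroD ⊗ x ⊕ oneD ⊗ oneD ≡ oneD
  only-one = solve-∀ Dual-ring

-- Coprimality propagates along a relation  s z = t x + c :  from u x + v c = 1 one
-- gets  (v z) s + (u - v t) x = 1.  This is how a new term of the sequence inherits
-- coprimality with its predecessors.
coprime-propagate : ∀ {s z t x c} → Integral z → Integral t →
                    s ⊗ z ≡ t ⊗ x ⊕ c → Coprime x c → Coprime s x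
coprime-propagate {s} {z} {t} {x} {c} iz it sz≡ (bezout u v iu iv e) =
  bezout (v ⊗ z) (u ⊕ negD (v ⊗ t)) (integral-⊗ iv iz) (integral-⊕ iu (integral-neg (integral-⊗ iv it))) $
  begin
    (v ⊗ z) ⊗ s ⊕ (u ⊕ negD (v ⊗ t)) ⊗ x  ≡⟨ regroup v z s u t x ⟩
    v ⊗ (s ⊗ z) ⊕ u ⊗ x ⊕ negD (v ⊗ t ⊗ x)  ≡⟨ cong (λ w → v ⊗ w ⊕ u ⊗ x ⊕ negD (v ⊗ t ⊗ x)) sz≡ ⟩
    v ⊗ (t ⊗ x ⊕ c) ⊕ u ⊗ x ⊕ negD (v ⊗ t ⊗ x)  ≡⟨ cancel v t x c u ⟩
    u ⊗ x ⊕ v ⊗ c  ≡⟨ e ⟩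
    oneD  ∎
  where
  open ≡-Reasoning
  regroup : ∀ v z s u t x →
    (v ⊗ z) ⊗ s ⊕ (u ⊕ negD (v ⊗ t)) ⊗ x ≡ v ⊗ (s ⊗ z) ⊕ u ⊗ x ⊕ negD (v ⊗ t ⊗ x)
  regroup = solve-∀ Dual-ring
  cancel : ∀ v t x c u → v ⊗ (t ⊗ x ⊕ c) ⊕ u ⊗ x ⊕ negD (v ⊗ t ⊗ x) ≡ u ⊗ x ⊕ v ⊗ c
  cancel = solve-∀ Dual-ring

-- Gauss's lemma: if z is coprime to g and z ∣ g t, then z ∣ t
-- (t = (u z + v g) t = z (u t) + v (g t)).
gauss : ∀ {z g t} → Integral t → Coprime z g → g ⊗ t ≈ zeroD [mod z ] → t ≈ zeroD [mod z ]
gauss {z} {g} {t} it (bezout u v iu iv e) (multiple n i-n gt≡) =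
  multiple (u ⊗ t ⊕ v ⊗ n) (integral-⊕ (integral-⊗ iu it) (integral-⊗ iv i-n)) $ begin
    t                                  ≡⟨ sym (⊗-identityˡ t) ⟩
    oneD ⊗ t                           ≡⟨ cong (_⊗ t) (sym e) ⟩
    (u ⊗ z ⊕ v ⊗ g) ⊗ t                ≡⟨ expand u z v g t ⟩
    z ⊗ (u ⊗ t) ⊕ v ⊗ (g ⊗ t)          ≡⟨ cong (λ w → z ⊗ (u ⊗ t) ⊕ v ⊗ w) gt≡ ⟩
    z ⊗ (u ⊗ t) ⊕ v ⊗ (zeroD ⊕ z ⊗ n)  ≡⟨ collect z u t v n ⟩
    zeroD ⊕ z ⊗ (u ⊗ t ⊕ v ⊗ n)        ∎
  where
  open ≡-Reasoning
  expand : ∀ u z v g t → (u ⊗ z ⊕ v ⊗ g) ⊗ t ≡ z ⊗ (u ⊗ t) ⊕ v ⊗ (g ⊗ t)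
  expand = solve-∀ Dual-ring
  collect : ∀ z u t v n → z ⊗ (u ⊗ t) ⊕ v ⊗ (zeroD ⊕ z ⊗ n) ≡ zeroD ⊕ z ⊗ (u ⊗ t ⊕ v ⊗ n)
  collect = solve-∀ Dual-ring

invℚ-inverse : ∀ a → a ≢ 0ℚ → invℚ a * a ≡ 1ℚ
invℚ-inverse a a≢0 with a ≟ 0ℚ
... | yes a≡0 = ⊥-elim (a≢0 a≡0)
... | no a≢0′ = ℚ.*-inverseˡ a {{≢-nonZero a≢0′}}

invD-inverse : ∀ z → re z ≢ 0ℚ → invD z ⊗ z ≡ oneD
invD-inverse (a + b ε) a≢0 = dual-≡ a⁻¹a≡1 $ begin
    a⁻¹ * b + (- (b * (a⁻¹ * a⁻¹))) * a  ≡⟨ regroup a⁻¹ a b ⟩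
    a⁻¹ * b + - (b * a⁻¹ * (a⁻¹ * a))    ≡⟨ cong (λ w → a⁻¹ * b + - (b * a⁻¹ * w)) a⁻¹a≡1 ⟩
    a⁻¹ * b + - (b * a⁻¹ * 1ℚ)           ≡⟨ cancel a⁻¹ b ⟩
    0ℚ                                    ∎
  where
  open ≡-Reasoning
  open +-*-Solver
  a⁻¹ = invℚ a
  a⁻¹a≡1 = invℚ-inverse a a≢0
  regroup : ∀ a⁻¹ a b → a⁻¹ * b + (- (b * (a⁻¹ * a⁻¹))) * a ≡ a⁻¹ * b + - (b * a⁻¹ * (a⁻¹ * a))
  regroup = solve 3 (λ a⁻¹ a b → a⁻¹ :* b :+ (:- (b :* (a⁻¹ :* a⁻¹))) :* a
                                 := a⁻¹ :* b :+ :- (b :* a⁻¹ :* (a⁻¹ :* a))) refl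
  cancel : ∀ a⁻¹ b → a⁻¹ * b + - (b * a⁻¹ * 1ℚ) ≡ 0ℚ
  cancel = solve 2 (λ a⁻¹ b → a⁻¹ :* b :+ :- (b :* a⁻¹ :* con 1ℚ) := con 0ℚ) refl

⊘-cancel : ∀ x z → re z ≢ 0ℚ → (x ⊘ z) ⊗ z ≡ x
⊘-cancel x z z≢0 = begin
  (x ⊗ invD z) ⊗ z  ≡⟨ ⊗-assoc x (invD z) z ⟩
  x ⊗ (invD z ⊗ z)  ≡⟨ cong (x ⊗_) (invD-inverse z z≢0) ⟩
  x ⊗ oneD          ≡⟨ ⊗-identityʳ x ⟩
  x                 ∎
  where open ≡-Reasoning

⊗-cancelˡ : ∀ z {x y} → re z ≢ 0ℚ → z ⊗ x ≡ z ⊗ y → x ≡ y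
⊗-cancelˡ z {x} {y} z≢0 zx≡zy = begin
  x                   ≡⟨ sym (⊗-identityˡ x) ⟩
  oneD ⊗ x            ≡⟨ cong (_⊗ x) (sym (invD-inverse z z≢0)) ⟩
  (invD z ⊗ z) ⊗ x    ≡⟨ ⊗-assoc (invD z) z x ⟩
  invD z ⊗ (z ⊗ x)    ≡⟨ cong (invD z ⊗_) zx≡zy ⟩
  invD z ⊗ (z ⊗ y)    ≡⟨ sym (⊗-assoc (invD z) z y) ⟩
  (invD z ⊗ z) ⊗ y    ≡⟨ cong (_⊗ y) (invD-inverse z z≢0) ⟩
  oneD ⊗ y            ≡⟨ ⊗-identityˡ y ⟩
  y                   ∎
  where open ≡-Reasoning

exact-quotient : ∀ {s z t} → re z ≢ 0ℚ → s ⊗ z ≡ t → t ≈ zeroD [mod z ] → Integral s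
exact-quotient {s} {z} {t} z≢0 sz≡t (multiple k ik t≡) =
  subst Integral (sym (⊗-cancelˡ z z≢0 zs≡zk)) ik
  where
  open ≡-Reasoning
  no-zero : ∀ z k → zeroD ⊕ z ⊗ k ≡ z ⊗ k
  no-zero = solve-∀ Dual-ring
  zs≡zk : z ⊗ s ≡ z ⊗ k
  zs≡zk = begin
    z ⊗ s              ≡⟨ ⊗-comm z s ⟩
    s ⊗ z              ≡⟨ sz≡t ⟩
    t                  ≡⟨ t≡ ⟩
    zeroD ⊕ z ⊗ k      ≡⟨ no-zero z k ⟩
    z ⊗ k              ∎

-- W X Y Z P Q R are seven consecutive terms: each of P, Q, R is obtained from its four
-- predecessors, and Z divides W Y + X² β (i.e. the term before W … Z is integral too).

module SomosStep
  {W X Y Z P Q R : Dual}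
  (iW : Integral W) (iX : Integral X) (iY : Integral Y) (iZ : Integral Z)
  (iP : Integral P) (iQ : Integral Q) (iR : Integral R)
  (P-rec : P ⊗ W ≡ X ⊗ Z ⊕ (Y ⊗ Y) ⊗ β)
  (Q-rec : Q ⊗ X ≡ Y ⊗ P ⊕ (Z ⊗ Z) ⊗ β)
  (R-rec : R ⊗ Y ≡ Z ⊗ Q ⊕ (P ⊗ P) ⊗ β)
  (Z∣WY+X²β : W ⊗ Y ⊕ (X ⊗ X) ⊗ β ≈ zeroD [mod Z ])
  where

  T : Dual
  T = P ⊗ R ⊕ (Q ⊗ Q) ⊗ β

  PW≈ : P ⊗ W ≈ (Y ⊗ Y) ⊗ β [mod Z ]
  PW≈ = multiple X iX (trans P-rec (swap X Z (Y ⊗ Y) β))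
    where
    swap : ∀ X Z c b → X ⊗ Z ⊕ c ⊗ b ≡ c ⊗ b ⊕ Z ⊗ X
    swap = solve-∀ Dual-ring

  QX≈ : Q ⊗ X ≈ Y ⊗ P [mod Z ]
  QX≈ = multiple (Z ⊗ β) (integral-⊗ iZ integral-β) (trans Q-rec (regroup Y P Z β))
    where
    regroup : ∀ Y P Z b → Y ⊗ P ⊕ (Z ⊗ Z) ⊗ b ≡ Y ⊗ P ⊕ Z ⊗ (Z ⊗ b)
    regroup = solve-∀ Dual-ring

  RY≈ : R ⊗ Y ≈ (P ⊗ P) ⊗ β [mod Z ]
  RY≈ = multiple Q iQ (trans R-rec (DualLaws.⊕-comm (Z ⊗ Q) ((P ⊗ P) ⊗ β)))

  -- The key congruence  W Y X² T ≡ 0 (mod Z):  modulo Z,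
  --   W Y X² T ≡ β P² (X² · P W + W Y³) ≡ β P² Y² (W Y + X² β) ≡ 0.
  key-congruence : (W ⊗ Y ⊗ (X ⊗ X)) ⊗ T ≈ zeroD [mod Z ]
  key-congruence = begin
    (W ⊗ Y ⊗ (X ⊗ X)) ⊗ T
      ≡⟨ expand W X Y P Q R β ⟩
    (W ⊗ (X ⊗ X) ⊗ P) ⊗ (R ⊗ Y) ⊕ (W ⊗ Y ⊗ β) ⊗ ((Q ⊗ X) ⊗ (Q ⊗ X))
      ∼⟨ ≈-+ (≈-scale (WXXP) RY≈) (≈-scale WYβ (≈-* iQX iYP QX≈ QX≈)) ⟩
    (W ⊗ (X ⊗ X) ⊗ P) ⊗ ((P ⊗ P) ⊗ β) ⊕ (W ⊗ Y ⊗ β) ⊗ ((Y ⊗ P) ⊗ (Y ⊗ P))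
      ≡⟨ factor-P²β W X Y P β ⟩
    ((P ⊗ P) ⊗ β) ⊗ ((X ⊗ X) ⊗ (P ⊗ W) ⊕ W ⊗ (Y ⊗ Y ⊗ Y))
      ∼⟨ ≈-scale P²β (≈-+ (≈-scale (integral-⊗ iX iX) PW≈) ≈-refl) ⟩
    ((P ⊗ P) ⊗ β) ⊗ ((X ⊗ X) ⊗ ((Y ⊗ Y) ⊗ β) ⊕ W ⊗ (Y ⊗ Y ⊗ Y))
      ≡⟨ factor-Y² W X Y P β ⟩
    (((P ⊗ P) ⊗ β) ⊗ (Y ⊗ Y)) ⊗ (W ⊗ Y ⊕ (X ⊗ X) ⊗ β)
      ∼⟨ ≈-scale (integral-⊗ P²β (integral-⊗ iY iY)) Z∣WY+X²β ⟩
    (((P ⊗ P) ⊗ β) ⊗ (Y ⊗ Y)) ⊗ zeroD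
      ≡⟨ annihilate (((P ⊗ P) ⊗ β) ⊗ (Y ⊗ Y)) ⟩
    zeroD ∎
    where
    open ≈-Reasoning Z
    WXXP = integral-⊗ (integral-⊗ iW (integral-⊗ iX iX)) iP
    WYβ  = integral-⊗ (integral-⊗ iW iY) integral-β
    iQX  = integral-⊗ iQ iX
    iYP  = integral-⊗ iY iP
    P²β  = integral-⊗ (integral-⊗ iP iP) integral-β
    expand : ∀ W X Y P Q R b → (W ⊗ Y ⊗ (X ⊗ X)) ⊗ (P ⊗ R ⊕ (Q ⊗ Q) ⊗ b)
      ≡ (W ⊗ (X ⊗ X) ⊗ P) ⊗ (R ⊗ Y) ⊕ (W ⊗ Y ⊗ b) ⊗ ((Q ⊗ X) ⊗ (Q ⊗ X))
    expand = solve-∀ Dual-ring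
    factor-P²β : ∀ W X Y P b →
      (W ⊗ (X ⊗ X) ⊗ P) ⊗ ((P ⊗ P) ⊗ b) ⊕ (W ⊗ Y ⊗ b) ⊗ ((Y ⊗ P) ⊗ (Y ⊗ P))
        ≡ ((P ⊗ P) ⊗ b) ⊗ ((X ⊗ X) ⊗ (P ⊗ W) ⊕ W ⊗ (Y ⊗ Y ⊗ Y))
    factor-P²β = solve-∀ Dual-ring
    factor-Y² : ∀ W X Y P b →
      ((P ⊗ P) ⊗ b) ⊗ ((X ⊗ X) ⊗ ((Y ⊗ Y) ⊗ b) ⊕ W ⊗ (Y ⊗ Y ⊗ Y))
        ≡ (((P ⊗ P) ⊗ b) ⊗ (Y ⊗ Y)) ⊗ (W ⊗ Y ⊕ (X ⊗ X) ⊗ b)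
    factor-Y² = solve-∀ Dual-ring
    annihilate : ∀ c → c ⊗ zeroD ≡ zeroD
    annihilate = solve-∀ Dual-ring

  next-integral : ∀ {S} → re Z ≢ 0ℚ → S ⊗ Z ≡ T →
                  Coprime Z W → Coprime Z X → Coprime Z Y → Integral S
  next-integral Z≢0 SZ≡T ZW ZX ZY = exact-quotient Z≢0 SZ≡T Z∣T
    where
    Z⊥WYX² : Coprime Z (W ⊗ Y ⊗ (X ⊗ X))
    Z⊥WYX² = coprime-* iZ (integral-⊗ iW iY) (integral-⊗ iX iX)
               (coprime-* iZ iW iY ZW ZY) (coprime-* iZ iX iX ZX ZX)
    iT : Integral T
    iT = integral-⊕ (integral-⊗ iP iR) (integral-⊗ (integral-⊗ iQ iQ) integral-β)
    Z∣T : T ≈ zeroD [mod Z ]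
    Z∣T = gauss iT Z⊥WYX² key-congruence

  next-coprime : ∀ {S} → S ⊗ Z ≡ T → Coprime Q P → Coprime R Q →
                 Coprime S P × Coprime S Q × Coprime S R
  next-coprime {S} SZ≡T QP RQ =
      coprime-propagate iZ iR (trans SZ≡T (cong (_⊕ (Q ⊗ Q) ⊗ β) (⊗-comm P R)))
        (coprime-*β (coprime-* iP iQ iQ PQ PQ))
    , coprime-propagate iZ (integral-⊗ iQ integral-β) (trans SZ≡T (swap P R Q β))
        (coprime-* iQ iP iR QP (coprime-sym RQ))
    , coprime-propagate iZ iP SZ≡T (coprime-*β (coprime-* iR iQ iQ RQ RQ))
    where
    PQ = coprime-sym QP
    swap : ∀ P R Q b → P ⊗ R ⊕ (Q ⊗ Q) ⊗ b ≡ (Q ⊗ b) ⊗ Q ⊕ P ⊗ R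
    swap = solve-∀ Dual-ring

-- The real parts a_n form the Somos-4 sequence 1, 1, 1, 1, 2, 3, 7, …; they are
-- positive, so every division in the definition of A is exact.

positive⇒≢0 : ∀ {p} → Positive p → p ≢ 0ℚ
positive⇒≢0 () refl

invℚ-positive : ∀ p → Positive p → Positive (invℚ p)
invℚ-positive p pos with p ≟ 0ℚ
... | yes p≡0 = ⊥-elim (positive⇒≢0 pos p≡0)
... | no _    = ℚ.1/pos⇒pos p {{pos}}

-- a_{m+5} = (a_{m+2} a_{m+4} + a_{m+3}²) / a_{m+1}, so positivity passes on along
-- windows of four consecutive terms.
positive-window : ∀ m → Positive (a (1 +ₙ m)) × Positive (a (2 +ₙ m)) × Positive (a (3 +ₙ m)) × Positive (a (4 +ₙ m))
positive-window zero = _ , _ , _ , _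
positive-window (suc m) with positive-window m
... | p₁ , p₂ , p₃ , p₄ = p₂ , p₃ , p₄ , next
  where
  a₂ = a (2 +ₙ m)
  a₃ = a (3 +ₙ m)
  a₄ = a (4 +ₙ m)
  numerator-positive : Positive (a₂ * a₄ + (a₃ * a₃) * 1ℚ)
  numerator-positive = ℚ.pos+pos⇒pos (a₂ * a₄) {{ℚ.pos*pos⇒pos a₂ {{p₂}} a₄ {{p₄}}}}
    ((a₃ * a₃) * 1ℚ) {{ℚ.pos*pos⇒pos (a₃ * a₃) {{ℚ.pos*pos⇒pos a₃ {{p₃}} a₃ {{p₃}}}} 1ℚ}}
  next : Positive (a (5 +ₙ m))
  next = ℚ.pos*pos⇒pos (a₂ * a₄ + (a₃ * a₃) * 1ℚ) {{numerator-positive}}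
           (invℚ (a (1 +ₙ m))) {{invℚ-positive (a (1 +ₙ m)) p₁}}

a≢0 : ∀ m → a (1 +ₙ m) ≢ 0ℚ
a≢0 m = positive⇒≢0 (proj₁ (positive-window m))

recurrence : ∀ m → A (5 +ₙ m) ⊗ A (1 +ₙ m) ≡ A (2 +ₙ m) ⊗ A (4 +ₙ m) ⊕ (A (3 +ₙ m) ⊗ A (3 +ₙ m)) ⊗ β
recurrence m = ⊘-cancel _ (A (1 +ₙ m)) (a≢0 m)

Coprime₃ : Dual → Dual → Dual → Dual → Set
Coprime₃ x a b c = Coprime x a × Coprime x b × Coprime x c

record Window (m : ℕ) : Set where
  field
    int₁ : Integral (A (1 +ₙ m))
    int₂ : Integral (A (2 +ₙ m))
    int₃ : Integral (A (3 +ₙ m))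
    int₄ : Integral (A (4 +ₙ m))
    int₅ : Integral (A (5 +ₙ m))
    int₆ : Integral (A (6 +ₙ m))
    int₇ : Integral (A (7 +ₙ m))
    divisible : A (1 +ₙ m) ⊗ A (3 +ₙ m) ⊕ (A (2 +ₙ m) ⊗ A (2 +ₙ m)) ⊗ β ≈ zeroD [mod A (4 +ₙ m) ]
    coprime₄ : Coprime₃ (A (4 +ₙ m)) (A (1 +ₙ m)) (A (2 +ₙ m)) (A (3 +ₙ m))
    coprime₅ : Coprime₃ (A (5 +ₙ m)) (A (2 +ₙ m)) (A (3 +ₙ m)) (A (4 +ₙ m))
    coprime₆ : Coprime₃ (A (6 +ₙ m)) (A (3 +ₙ m)) (A (4 +ₙ m)) (A (5 +ₙ m))
    coprime₇ : Coprime₃ (A (7 +ₙ m)) (A (4 +ₙ m)) (A (5 +ₙ m)) (A (6 +ₙ m))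

-- A_1, …, A_7 = 1, 1, 1, 1, 2+ε, 3+2ε, 7+10ε, with explicit Bézout identities such as
-- (1-ε)(3+2ε) + (-1+ε)(2+ε) = 1.
window-initial : Window 0
window-initial = record
  { int₁ = integral-1 ; int₂ = integral-1 ; int₃ = integral-1 ; int₄ = integral-1
  ; int₅ = ℤ-dual-integral (+ 2) (+ 1)
  ; int₆ = ℤ-dual-integral (+ 3) (+ 2)
  ; int₇ = ℤ-dual-integral (+ 7) (+ 10)
  ; divisible = multiple (ℤ-dual (+ 2) (+ 1)) (ℤ-dual-integral (+ 2) (+ 1)) refl
  ; coprime₄ = coprime-1 _ , coprime-1 _ , coprime-1 _
  ; coprime₅ = coprime-1 _ , coprime-1 _ , coprime-1 _
  ; coprime₆ = coprime-1 _ , coprime-1 _ , coprime (+ 1) -[1+ 0 ] -[1+ 0 ] (+ 1) refl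
  ; coprime₇ = coprime-1 _ , coprime (+ 1) -[1+ 0 ] -[1+ 2 ] (+ 0) refl
             , coprime (+ 1) (+ 0) -[1+ 1 ] -[1+ 1 ] refl
  }
  where
  coprime : ∀ i j k l {x y} → ℤ-dual i j ⊗ x ⊕ ℤ-dual k l ⊗ y ≡ oneD → Coprime x y
  coprime i j k l = bezout (ℤ-dual i j) (ℤ-dual k l) (ℤ-dual-integral i j) (ℤ-dual-integral k l)

window-step : ∀ m → Window m → Window (suc m)
window-step m w = record
  { int₁ = int₂ ; int₂ = int₃ ; int₃ = int₄ ; int₄ = int₅ ; int₅ = int₆ ; int₆ = int₇
  ; int₇ = next-integral (a≢0 (3 +ₙ m)) (recurrence (3 +ₙ m)) ZW ZX ZY
  ; divisible = multiple (A (1 +ₙ m)) int₁ (trans (sym (recurrence m)) (zero-+ (A (5 +ₙ m)) (A (1 +ₙ m))))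
  ; coprime₄ = coprime₅ ; coprime₅ = coprime₆ ; coprime₆ = coprime₇
  ; coprime₇ = next-coprime (recurrence (3 +ₙ m)) QP RQ
  }
  where
  open Window w
  open SomosStep int₁ int₂ int₃ int₄ int₅ int₆ int₇
         (recurrence m) (recurrence (1 +ₙ m)) (recurrence (2 +ₙ m)) divisible
  ZW = proj₁ coprime₄
  ZX = proj₁ (proj₂ coprime₄)
  ZY = proj₂ (proj₂ coprime₄)
  QP = proj₂ (proj₂ coprime₆)
  RQ = proj₂ (proj₂ coprime₇)
  zero-+ : ∀ p w → p ⊗ w ≡ zeroD ⊕ p ⊗ w
  zero-+ = solve-∀ Dual-ring

window : ∀ m → Window m
window zero    = window-initial
window (suc m) = window-step m (window m)

corollary7p1 : ∀ (n : ℕ) → n ≥ 1 → IsInteger (a n) × IsInteger (b n)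
corollary7p1 (suc m) _ = Window.int₁ (window m)
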